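{- Let $\mathcal C$ be any collection of languages over a countably infinite universe $U$ and let $i \ge 1$ be an integer. The following are equivalent: (1) there exists a countable sequence of collections $\mathcal C_0 \subseteq \mathcal C_1 \subseteq \cdots$ such that $\mathcal C = \bigcup_{j\in\mathbb N}\mathcal C_j$ and $\mathrm{NC}_1(\mathcal C_j) < \infty$ for all $j \in\mathbb N$; (2) $\mathcal C$ is non-uniformly generatable with noise level $i$; (3) $\mathcal C$ is non-uniformly noise-dependently generatable. However, there exists a collection that is non-uniformly generatable without noise (i.e., with noise level $0$), but is not non-uniformly generatable with noise level $1$.
   Context: A language is an infinite subset of $U$; a collection is a (possibly uncountable) set of languages. For $i \in \mathbb N=\{0,1,\dots\}$, an enumeration of a language $K$ with noise level $i$ is an infinite sequence $x_0, x_1, \dots$ of elements of $U$ without repetitions such that $K \subseteq \{x_j : j \in \mathbb N\}$ and $|\{x_j : j\in\mathbb N\} \setminus K| \le i$. Write $S_t = \{x_0,\dots,x_t\}$. A generator algorithm is a function $G : U^* \to U$; at time $t$ it outputs $z_t = G(x_0,\dots,x_t)$. $G$ non-uniformly generates with noise level $i$ for $\mathcal C$ if for every $K\in\mathcal C$ there exists $t^\star$ such that for every enumeration of $K$ with noise level at most $i$ and all $t\ge t^\star$, $z_t\in K\setminus S_t$. $G$ non-uniformly noise-dependently generates for $\mathcal C$ if for every $n^\star\in\mathbb N$ and every $K\in\mathcal C$ there exists $t^\star$ such that for every enumeration of $K$ with noise level $n^\star$ and all $t\ge t^\star$, $z_t\in K\setminus S_t$. A collection is generatable in a given sense if such an algorithm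 exists. For $S \subseteq U$, $\mathcal C(S,i) = \{L \in \mathcal C : |S\setminus L| \le i\}$; $\langle S\rangle_{\mathcal C,i} = \bigcap_{L\in\mathcal C(S,i)} L$ if $\mathcal C(S,i)\neq\emptyset$, else $\emptyset$. $\mathrm{NC}_i(\mathcal C)$ is the size of the largest finite set $S$ with $\mathcal C(S,i)\neq\emptyset$ and $|\langle S\rangle_{\mathcal C,i}|<\infty$, and $\infty$ if there are arbitrarily large such sets. -}

module Defs where

open import Level using (Level; 0ℓ; _⊔_)
open import Data.Nat using (ℕ; zero; suc; _≤_)
open import Data.List using (List; length; map; upTo)
open import Data.List.Membership.Propositional using (_∈_)
open import Data.List.Relation.Unary.Unique.Propositional using (Unique)
open import Data.Product using (Σ; _×_; ∃)
open import Relation.Nullary using (¬_)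
open import Relation.Binary.PropositionalEquality using (_≡_)
open import Function.Definitions using (Injective)
open import Function.Bundles using (_⇔_)

module _ {U : Set} where

  Subset : Set₁
  Subset = U → Set

  AtMost : ℕ → Subset → Set
  AtMost n P = Σ (List U) λ ys → length ys ≤ n × (∀ u → P u → u ∈ ys)

  Finite : ∀ {ℓ} → (U → Set ℓ) → Set ℓ
  Finite P = Σ (List U) λ ys → ∀ u → P u → u ∈ ys

  Infinite : Subset → Set
  Infinite P = ¬ Finite P

  Collection : Set₁
  Collection = Subset → Set

  IsCollection : Collection → Set₁
  IsCollection C = ∀ L → C L → Infinite L

  IsEnumeration : Subset → (ℕ → U) → ℕ → Set
  IsEnumeration K x i =
    Injective _≡_ _≡_ x
    × (∀ u → K u → ∃ λ j → x j ≡ u)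
    × AtMost i (λ u → (∃ λ j → x j ≡ u) × ¬ K u)

  prefix : (ℕ → U) → ℕ → List U
  prefix x t = map x (upTo (suc t))

  Generator : Set
  Generator = List U → U

  GoodAt : Generator → Subset → (ℕ → U) → ℕ → Set
  GoodAt G K x t = K (G (prefix x t)) × ¬ (G (prefix x t) ∈ prefix x t)

  NonUnifGenerates : Generator → Collection → ℕ → Set₁
  NonUnifGenerates G C i =
    ∀ K → C K → Σ ℕ λ tstar →
      ∀ x → IsEnumeration K x i → ∀ t → tstar ≤ t → GoodAt G K x t

  NonUnifNoiseDepGenerates : Generator → Collection → Set₁
  NonUnifNoiseDepGenerates G C =
    ∀ (nstar : ℕ) K → C K → Σ ℕ λ tstar →
      ∀ x → IsEnumeration K x nstar → ∀ t → tstar ≤ t → GoodAt G K x t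

  NonUnifGeneratable : Collection → ℕ → Set₁
  NonUnifGeneratable C i = Σ Generator λ G → NonUnifGenerates G C i

  NonUnifNoiseDepGeneratable : Collection → Set₁
  NonUnifNoiseDepGeneratable C = Σ Generator λ G → NonUnifNoiseDepGenerates G C

  InCS : Collection → List U → ℕ → Subset → Set
  InCS C S i L = C L × AtMost i (λ u → u ∈ S × ¬ L u)

  -- ⟨S⟩_{C,i}: intersection of C(S,i) if nonempty, else ∅.
  Closure : Collection → List U → ℕ → U → Set₁
  Closure C S i u = (∃ λ L → InCS C S i L) × (∀ L → InCS C S i L → L u)

  NCBoundedBy : Collection → ℕ → ℕ → Set₁
  NCBoundedBy C i d =
    ∀ (S : List U) → Unique S → (∃ λ L → InCS C S i L) →
      Finite (Closure C S i) → length S ≤ d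

  NCFinite : Collection → ℕ → Set₁
  NCFinite C i = ∃ λ d → NCBoundedBy C i d

  Condition1 : Collection → Set₁
  Condition1 C =
    Σ (ℕ → Collection) λ Cs →
      (∀ j L → Cs j L → Cs (suc j) L)
      × (∀ L → C L ⇔ (∃ λ j → Cs j L))
      × (∀ j → NCFinite (Cs j) 1)

-- If G generates with noise 1, the languages it generates from time j on form a
-- chain C₀ ⊆ C₁ ⊆ ⋯ with NC₁(C_j) ≤ j: from more than j points of S, feeding G its
-- own outputs produces infinitely many points that lie in every L ∈ C_j(S,1).
-- Conversely, NC₁ < ∞ bounds every NC_{i+1}: split a large S into blocks whose
-- (i+1)-closures are infinite and pick a point from each; a language with i+2
-- errors on S has at most one block with i+2 errors, so it misses at most one of
-- these points.  A generator that at time t uses the (k+1)-noisy closure in C_k,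
-- for the largest k whose bound is below t, then works at every noise level.
-- The nonempty unions of columns of U ≅ ℕ × ℕ are generatable without noise, but
-- one noisy element lets a diagonalisation defeat any generator: we build a union
-- of columns omitting exactly the columns G outputs on long rows of column heads.
module Submission where

open import Level using (0ℓ; lift; lower) renaming (suc to lsuc)
open import Axiom.ExcludedMiddle using (ExcludedMiddle)
open import Data.Empty using (⊥; ⊥-elim)
open import Data.Nat using (ℕ; zero; suc; _+_; _*_; _∸_; _⊔_; _≤_; _<_; _≤′_; _≤?_; _<?_; z≤n; s≤s; ≤′-refl; ≤′-step) renaming (_≟_ to _≟ℕ_)
open import Data.Nat.Properties hiding (_≟_)
open import Data.Nat.Induction using (<-rec)
open import Data.Nat.ListAction using (sum)
open import Data.List using (List; []; _∷_; length; map; upTo; applyUpTo; _++_; take; drop; filter)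
open import Data.List.Properties
  using (length-map; length-upTo; length-applyUpTo; map-upTo; length-++; length-++-≤ʳ; length-take; length-drop; take++drop≡id; filter-notAll)
open import Data.List.Membership.Propositional using (_∈_; _∉_)
open import Data.List.Membership.Propositional.Properties
  using (∈-map⁺; ∈-map⁻; ∈-++⁺ˡ; ∈-++⁺ʳ; ∈-++⁻; ∈-filter⁺; ∈-filter⁻; ∈-upTo⁺; ∈-applyUpTo⁻)
open import Data.List.Relation.Binary.Subset.Propositional using (_⊆_)
open import Data.List.Relation.Binary.Subset.Propositional.Properties using (filter-⊆)
open import Data.List.Relation.Unary.Any using (here; there)
import Data.List.Relation.Unary.Any as Any
import Data.List.Relation.Unary.All as All
open import Data.List.Relation.Unary.All.Properties using (¬Any⇒All¬)
open import Data.List.Relation.Unary.AllPairs using ([]; _∷_)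
open import Data.List.Relation.Unary.Unique.Propositional using (Unique)
open import Data.List.Relation.Unary.Unique.Propositional.Properties
  using (map⁺; upTo⁺; applyUpTo⁺₁; take⁺; drop⁺; filter⁺; Unique[x∷xs]⇒x∉xs)
open import Data.Product using (Σ; ∃; _×_; _,_; proj₁; proj₂)
open import Data.Product.Properties using (,-injectiveʳ)
open import Data.Sum using (_⊎_; inj₁; inj₂)
open import Function using (_∘_; case_of_)
open import Function.Bundles using (_↔_; _⇔_; Inverse; mk⇔; Equivalence)
open import Function.Definitions using (Injective)
open import Relation.Nullary using (¬_; Dec; yes; no; ¬?)
open import Relation.Nullary.Decidable using (map′; decidable-stable; _×-dec_)
open import Relation.Unary using (Pred; Decidable)
open import Relation.Binary.Definitions using (DecidableEquality; tri<; tri≈; tri>)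
open import Relation.Binary.PropositionalEquality using (_≡_; _≢_; refl; sym; trans; cong; subst)
open import Defs

module _ {a} {A : Set a} where

  Unique-⊆⇒length≤ : DecidableEquality A → ∀ {xs ys : List A} → Unique xs → xs ⊆ ys →
                     length xs ≤ length ys
  Unique-⊆⇒length≤ _≟_ {[]} _ _ = z≤n
  Unique-⊆⇒length≤ _≟_ {x ∷ xs} {ys} (x∉xs ∷ uxs) x∷xs⊆ys = begin-strict
    length xs                        ≤⟨ Unique-⊆⇒length≤ _≟_ uxs xs⊆ys-x ⟩
    length (filter (¬? ∘ (x ≟_)) ys) <⟨ filter-notAll (¬? ∘ (x ≟_)) ys x∈ys ⟩
    length ys                        ∎
    where
    open ≤-Reasoning
    x∈ys = Any.map (λ x≡y x≢y → x≢y x≡y) (x∷xs⊆ys (here refl))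
    xs⊆ys-x : xs ⊆ filter (¬? ∘ (x ≟_)) ys
    xs⊆ys-x u∈xs = ∈-filter⁺ (¬? ∘ (x ≟_)) (x∷xs⊆ys (there u∈xs)) (All.lookup x∉xs u∈xs)

  take-⊆ : ∀ n {xs : List A} → take n xs ⊆ xs
  take-⊆ n {xs} u∈ = subst (_ ∈_) (take++drop≡id n xs) (∈-++⁺ˡ u∈)

  drop-⊆ : ∀ n {xs : List A} → drop n xs ⊆ xs
  drop-⊆ n {xs} u∈ = subst (_ ∈_) (take++drop≡id n xs) (∈-++⁺ʳ (take n xs) u∈)

  Unique-take-drop-disjoint : ∀ n {xs : List A} {u} → Unique xs → u ∈ take n xs → u ∉ drop n xs
  Unique-take-drop-disjoint (suc n) {x ∷ xs} (x∉xs ∷ _) (here refl) u∈drop =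
    All.lookup x∉xs (drop-⊆ n u∈drop) refl
  Unique-take-drop-disjoint (suc n) {x ∷ xs} (_ ∷ uxs) (there u∈take) =
    Unique-take-drop-disjoint n uxs u∈take

  prepend : List A → (ℕ → A) → ℕ → A
  prepend [] z m = z m
  prepend (p ∷ P) z zero = p
  prepend (p ∷ P) z (suc m) = prepend P z m

  prepend-prefix : ∀ P z → map (prepend P z) (upTo (length P)) ≡ P
  prepend-prefix P z = trans (map-upTo (prepend P z) (length P)) (applyUpTo-prepend P)
    where
    applyUpTo-prepend : ∀ P → applyUpTo (prepend P z) (length P) ≡ P
    applyUpTo-prepend [] = refl
    applyUpTo-prepend (p ∷ P) = cong (p ∷_) (applyUpTo-prepend P)

  prepend-shift : ∀ P z r → prepend P z (length P + r) ≡ z r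
  prepend-shift [] z r = refl
  prepend-shift (p ∷ P) z r = prepend-shift P z r

  prepend-covers : ∀ {u} P z → u ∈ P → ∃ λ m → prepend P z m ≡ u
  prepend-covers (p ∷ P) z (here refl) = zero , refl
  prepend-covers (p ∷ P) z (there u∈P) with m , e ← prepend-covers P z u∈P = suc m , e

  prepend-range : ∀ P z m → prepend P z m ∈ P ⊎ ∃ λ r → z r ≡ prepend P z m
  prepend-range [] z m = inj₂ (m , refl)
  prepend-range (p ∷ P) z zero = inj₁ (here refl)
  prepend-range (p ∷ P) z (suc m) with prepend-range P z m
  ... | inj₁ ∈P = inj₁ (there ∈P)
  ... | inj₂ r = inj₂ r

  prepend-avoids : ∀ {u} P z → u ∉ P → (∀ r → z r ≢ u) → ∀ m → prepend P z m ≢ u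
  prepend-avoids P z u∉P z≢u m e with prepend-range P z m
  ... | inj₁ ∈P = u∉P (subst (_∈ P) e ∈P)
  ... | inj₂ (r , zr≡) = z≢u r (trans zr≡ e)

  prepend-injective : ∀ {P z} → Unique P → Injective _≡_ _≡_ z → (∀ r → z r ∉ P) →
                      Injective _≡_ _≡_ (prepend P z)
  prepend-injective {[]} _ z-inj _ = z-inj
  prepend-injective {p ∷ P} _ _ _ {zero} {zero} _ = refl
  prepend-injective {p ∷ P} {z} uP z-inj z∉ {zero} {suc m} e =
    ⊥-elim (prepend-avoids P z (Unique[x∷xs]⇒x∉xs uP) (λ r zr≡p → z∉ r (here zr≡p)) m (sym e))
  prepend-injective {p ∷ P} {z} uP z-inj z∉ {suc m} {zero} e =
    ⊥-elim (prepend-avoids P z (Unique[x∷xs]⇒x∉xs uP) (λ r zr≡p → z∉ r (here zr≡p)) m e)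
  prepend-injective {p ∷ P} {z} (_ ∷ uP) z-inj z∉ {suc m} {suc m′} e =
    cong suc (prepend-injective uP z-inj (λ r → z∉ r ∘ there) e)

∈⇒≤sum : ∀ {n ns} → n ∈ ns → n ≤ sum ns
∈⇒≤sum {ns = m ∷ ns} (here refl) = m≤m+n m (sum ns)
∈⇒≤sum {ns = m ∷ ns} (there n∈ns) = ≤-trans (∈⇒≤sum n∈ns) (m≤n+m (sum ns) m)

module _ {p} {P : Pred ℕ p} (P? : Decidable P) where

  minimal : ∀ {n} → P n → ∃ λ k → P k × (∀ {j} → j < k → ¬ P j)
  minimal {n} = <-rec (λ n → P n → Minimal) step n
    where
    Minimal = ∃ λ k → P k × (∀ {j} → j < k → ¬ P j)
    step : ∀ n → (∀ {m} → m < n → P m → Minimal) → P n → Minimal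
    step n below pn with anyUpTo? P? n
    ... | yes (m , m<n , pm) = below m<n pm
    ... | no none = n , pn , λ j<n pj → none (_ , j<n , pj)

  -- Junk value 0 when no m ≤ k satisfies P.
  greatest : ℕ → ℕ
  greatest zero = zero
  greatest (suc k) with P? (suc k)
  ... | yes _ = suc k
  ... | no _ = greatest k

  greatest-spec : ∀ {m k} → m ≤ k → P m → m ≤ greatest k × P (greatest k)
  greatest-spec {k = zero} z≤n pm = z≤n , pm
  greatest-spec {k = suc k} m≤1+k pm with P? (suc k)
  ... | yes p[1+k] = m≤1+k , p[1+k]
  ... | no ¬p[1+k] with m≤n⇒m<n∨m≡n m≤1+k
  ...   | inj₁ m<1+k = greatest-spec (≤-pred m<1+k) pm
  ...   | inj₂ refl = ⊥-elim (¬p[1+k] pm)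

module IncreasingEnumeration {p} {Q : Pred ℕ p} (Q? : Decidable Q)
                             (unbounded : ∀ m → ∃ λ n → m ≤ n × Q n) where

  private
    next-spec : ∀ m → ∃ λ k → (m ≤ k × Q k) × (∀ {j} → j < k → ¬ (m ≤ j × Q j))
    next-spec m = minimal (λ n → m ≤? n ×-dec Q? n) (proj₂ (unbounded m))

    next : ℕ → ℕ
    next m = proj₁ (next-spec m)

    m≤next : ∀ m → m ≤ next m
    m≤next m = proj₁ (proj₁ (proj₂ (next-spec m)))

    next-≤ : ∀ {m n} → m ≤ n → Q n → next m ≤ n
    next-≤ {m} m≤n qn = ≮⇒≥ λ n<next → proj₂ (proj₂ (next-spec m)) n<next (m≤n , qn)

  enum : ℕ → ℕ
  enum zero = next 0
  enum (suc r) = next (suc (enum r))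

  enum-Q : ∀ r → Q (enum r)
  enum-Q zero = proj₂ (proj₁ (proj₂ (next-spec 0)))
  enum-Q (suc r) = proj₂ (proj₁ (proj₂ (next-spec (suc (enum r)))))

  enum-<-suc : ∀ r → enum r < enum (suc r)
  enum-<-suc r = m≤next (suc (enum r))

  enum-increasing : ∀ {r s} → r < s → enum r < enum s
  enum-increasing {r} {suc s} (s≤s r≤s) with m≤n⇒m<n∨m≡n r≤s
  ... | inj₁ r<s = <-trans (enum-increasing r<s) (enum-<-suc s)
  ... | inj₂ refl = enum-<-suc r

  enum-injective : Injective _≡_ _≡_ enum
  enum-injective {r} {s} e with <-cmp r s
  ... | tri< r<s _ _ = ⊥-elim (<⇒≢ (enum-increasing r<s) e)
  ... | tri≈ _ r≡s _ = r≡s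
  ... | tri> _ _ s<r = ⊥-elim (<⇒≢ (enum-increasing s<r) (sym e))

  n≤enum : ∀ n → n ≤ enum n
  n≤enum zero = z≤n
  n≤enum (suc n) = ≤-trans (s≤s (n≤enum n)) (enum-<-suc n)

  enum-surjective : ∀ {n} → Q n → ∃ λ r → enum r ≡ n
  enum-surjective {n} = below n (n≤enum n)
    where
    below : ∀ r → n ≤ enum r → Q n → ∃ λ s → enum s ≡ n
    below zero n≤e qn = zero , ≤-antisym (next-≤ z≤n qn) n≤e
    below (suc r) n≤e qn with n ≤? enum r
    ... | yes n≤e′ = below r n≤e′ qn
    ... | no n≰e′ = suc r , ≤-antisym (next-≤ (≰⇒> n≰e′) qn) n≤e

-- Cantor's enumeration of ℕ × ℕ along the antidiagonals a + b = s.
module CantorPairing where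

  triangle : ℕ → ℕ
  triangle zero = zero
  triangle (suc s) = suc s + triangle s

  step : ℕ × ℕ → ℕ × ℕ
  step (a , zero) = zero , suc a
  step (a , suc b) = suc a , b

  unpair : ℕ → ℕ × ℕ
  unpair zero = zero , zero
  unpair (suc n) = step (unpair n)

  pair : ℕ → ℕ → ℕ
  pair a b = a + triangle (a + b)

  private
    mutual
      unpair-triangle : ∀ s → unpair (triangle s) ≡ (zero , s)
      unpair-triangle zero = refl
      unpair-triangle (suc s) =
        trans (cong step (unpair-antidiagonal s s ≤-refl)) (cong (λ d → step (s , d)) (n∸n≡0 s))

      unpair-antidiagonal : ∀ a s → a ≤ s → unpair (a + triangle s) ≡ (a , s ∸ a)
      unpair-antidiagonal zero s _ = unpair-triangle s
      unpair-antidiagonal (suc a) (suc s) (s≤s a≤s) =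
        trans (cong step (unpair-antidiagonal a (suc s) (m≤n⇒m≤1+n a≤s)))
              (cong (λ d → step (a , d)) (+-∸-assoc 1 a≤s))

  unpair-pair : ∀ a b → unpair (pair a b) ≡ (a , b)
  unpair-pair a b = trans (unpair-antidiagonal a (a + b) (m≤m+n a b)) (cong (a ,_) (m+n∸m≡n a b))

  b≤pair : ∀ a b → b ≤ pair a b
  b≤pair a b = ≤-trans (m≤n+m b a) (≤-trans (n≤triangle (a + b)) (m≤n+m _ a))
    where
    n≤triangle : ∀ n → n ≤ triangle n
    n≤triangle zero = z≤n
    n≤triangle (suc n) = m≤m+n (suc n) (triangle n)

module _ {U : Set} where

  AtMost-mono : ∀ {m n} {P : Subset {U}} → m ≤ n → AtMost m P → AtMost n P
  AtMost-mono m≤n (ys , len≤m , cover) = ys , ≤-trans len≤m m≤n , cover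

  AtMost-⊆ : ∀ {n} {P Q : Subset {U}} → (∀ u → P u → Q u) → AtMost n Q → AtMost n P
  AtMost-⊆ P⊆Q (ys , len≤n , cover) = ys , len≤n , λ u → cover u ∘ P⊆Q u

  AtMost-zero : ∀ {P : Subset {U}} → AtMost 0 P → ∀ u → ¬ P u
  AtMost-zero ([] , _ , cover) u Pu with () ← cover u Pu

  Finite-⊆ : ∀ {ℓ ℓ′} {P : U → Set ℓ} {Q : U → Set ℓ′} → (∀ u → P u → Q u) → Finite Q → Finite P
  Finite-⊆ P⊆Q (ys , cover) = ys , λ u → cover u ∘ P⊆Q u

  IsEnumeration-mono : ∀ {K x m n} → m ≤ n → IsEnumeration K x m → IsEnumeration K x n
  IsEnumeration-mono m≤n (inj , covers , noise) = inj , covers , AtMost-mono m≤n noise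

  length-prefix : ∀ (x : ℕ → U) t → length (prefix x t) ≡ suc t
  length-prefix x t = trans (length-map x (upTo (suc t))) (length-upTo (suc t))

  Unique-prefix : ∀ {x : ℕ → U} t → Injective _≡_ _≡_ x → Unique (prefix x t)
  Unique-prefix t x-inj = map⁺ x-inj (upTo⁺ (suc t))

  prefix-noise : ∀ {K x n} t → IsEnumeration K x n → AtMost n (λ u → u ∈ prefix x t × ¬ K u)
  prefix-noise {x = x} t (_ , _ , noise) = AtMost-⊆ in-range noise
    where
    in-range : ∀ u → u ∈ prefix x t × ¬ _ → (∃ λ j → x j ≡ u) × ¬ _
    in-range u (u∈ , ¬Ku) with j , _ , refl ← ∈-map⁻ x u∈ = (j , refl) , ¬Ku

  InCS-antitone : ∀ {C : Collection {U}} {S T i L} → T ⊆ S → InCS C S i L → InCS C T i L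
  InCS-antitone T⊆S (CL , noise) = CL , AtMost-⊆ (λ u (u∈T , ¬Lu) → T⊆S u∈T , ¬Lu) noise

  Closure-antitone : ∀ {C D : Collection {U}} {S T i j} → (∀ L → InCS C S i L → InCS D T j L) →
                     ∃ (InCS C S i) → ∀ u → Closure D T j u → Closure C S i u
  Closure-antitone C⊆D nonempty u (_ , u∈all) = nonempty , λ L → u∈all L ∘ C⊆D L

  NCBoundedBy⇒Infinite : ∀ {C : Collection {U}} {i d S} → NCBoundedBy C i d → Unique S →
                         d < length S → ∃ (InCS C S i) → ¬ Finite (Closure C S i)
  NCBoundedBy⇒Infinite bound uS d<|S| nonempty fin = <⇒≱ d<|S| (bound _ uS nonempty fin)

  GeneratesFrom : Generator {U} → Subset {U} → ℕ → ℕ → Set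
  GeneratesFrom G K i t⋆ = ∀ x → IsEnumeration K x i → ∀ t → t⋆ ≤ t → GoodAt G K x t

  GoodOn : Generator {U} → Subset {U} → List U → Set
  GoodOn G K P = K (G P) × G P ∉ P

  GeneratesFrom-mono : ∀ {G K i s t} → s ≤ t → GeneratesFrom G K i s → GeneratesFrom G K i t
  GeneratesFrom-mono s≤t gen x en t t≤ = gen x en t (≤-trans s≤t t≤)

  NonUnifGenerates-mono : ∀ {G C i j} → j ≤ i → NonUnifGenerates G C i → NonUnifGenerates G C j
  NonUnifGenerates-mono j≤i gen K CK =
    proj₁ (gen K CK) , λ x en → proj₂ (gen K CK) x (IsEnumeration-mono j≤i en)

module Classical (em : ExcludedMiddle (lsuc 0ℓ)) (U : Set) (U↔ℕ : U ↔ ℕ) where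

  open Inverse U↔ℕ using (to; from; strictlyInverseˡ; strictlyInverseʳ)

  decide : (P : Set) → Dec P
  decide P = map′ lower lift em

  _≟_ : DecidableEquality U
  u ≟ v = decide (u ≡ v)

  from-injective : Injective _≡_ _≡_ from
  from-injective {m} {n} e = trans (sym (strictlyInverseˡ m)) (trans (cong to e) (strictlyInverseˡ n))

  -- The junk value from 0 is returned only when P ⊆ zs.
  freshIn : (U → Set₁) → List U → U
  freshIn P zs with em {∃ λ u → P u × u ∉ zs}
  ... | yes (u , _) = u
  ... | no _ = from 0

  freshIn-spec : ∀ {P : U → Set₁} zs → ¬ Finite P → P (freshIn P zs) × freshIn P zs ∉ zs
  freshIn-spec {P} zs infinite with em {∃ λ u → P u × u ∉ zs}
  ... | yes (_ , spec) = spec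
  ... | no none = ⊥-elim (infinite (zs , λ u Pu → decidable-stable (decide (u ∈ zs)) λ u∉zs → none (u , Pu , u∉zs)))

  injection⇒Infinite : ∀ {P : Subset {U}} {f : ℕ → U} → Injective _≡_ _≡_ f → (∀ r → P (f r)) → Infinite P
  injection⇒Infinite {f = f} f-inj Pf (ys , cover) = 1+n≰n (begin
    suc (length ys)    ≡⟨ sym (trans (length-map f (upTo n)) (length-upTo n)) ⟩
    length image       ≤⟨ Unique-⊆⇒length≤ _≟_ (map⁺ f-inj (upTo⁺ n)) image⊆ys ⟩
    length ys          ∎)
    where
    open ≤-Reasoning
    n = suc (length ys)
    image = map f (upTo n)
    image⊆ys : image ⊆ ys
    image⊆ys u∈ with r , _ , refl ← ∈-map⁻ f u∈ = cover (f r) (Pf r)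

  Infinite-∖ : ∀ {K : Subset {U}} P → Infinite K → Infinite (λ u → K u × u ∉ P)
  Infinite-∖ P infinite (ys , cover) = infinite (ys ++ P , λ u Ku → case decide (u ∈ P) of λ where
    (yes u∈P) → ∈-++⁺ʳ ys u∈P
    (no u∉P) → ∈-++⁺ˡ (cover u (Ku , u∉P)))

  enumerate : ∀ {R : Subset {U}} → Infinite R → Σ (ℕ → U) λ z → IsEnumeration R z 0
  enumerate {R} infinite =
    from ∘ enum , enum-injective ∘ from-injective , onto , [] , z≤n , λ where
      _ ((r , refl) , ¬R) → ⊥-elim (¬R (enum-Q r))
    where
    R-below : ∀ m → ¬ (∃ λ n → m ≤ n × R (from n)) → ∀ u → R u → u ∈ map from (upTo m)
    R-below m none u Ru = subst (_∈ _) (strictlyInverseʳ u) (∈-map⁺ from (∈-upTo⁺ (≰⇒> λ m≤ → none (to u , m≤ , Rft))))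
      where Rft = subst R (sym (strictlyInverseʳ u)) Ru
    unbounded : ∀ m → ∃ λ n → m ≤ n × R (from n)
    unbounded m = decidable-stable (decide _) λ none → infinite (_ , R-below m none)
    open IncreasingEnumeration (λ n → decide (R (from n))) unbounded
    onto : ∀ u → R u → ∃ λ r → from (enum r) ≡ u
    onto u Ru with r , e ← enum-surjective (subst R (sym (strictlyInverseʳ u)) Ru) =
      r , trans (cong from e) (strictlyInverseʳ u)

  extendToEnumeration : ∀ {K : Subset {U}} {n t P} → Infinite K → Unique P →
                        AtMost n (λ u → u ∈ P × ¬ K u) → length P ≡ suc t →
                        Σ (ℕ → U) λ x → IsEnumeration K x n × prefix x t ≡ P
  extendToEnumeration {K} {n} {P = P@(_ ∷ _)} infinite uP noise refl
    with z , z-inj , z-onto , z-noise ← enumerate (Infinite-∖ P infinite) =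
    x , (prepend-injective uP z-inj (proj₂ ∘ z-new) , covers , range-noise) , prepend-prefix P z
    where
    x = prepend P z
    z-new : ∀ r → K (z r) × z r ∉ P
    z-new r = decidable-stable (decide _) λ ¬new → AtMost-zero z-noise (z r) ((r , refl) , ¬new)
    covers : ∀ u → K u → ∃ λ j → x j ≡ u
    covers u Ku with decide (u ∈ P)
    ... | yes u∈P = prepend-covers P z u∈P
    ... | no u∉P with r , refl ← z-onto u (Ku , u∉P) = length P + r , prepend-shift P z r
    range-noise : AtMost n (λ u → (∃ λ j → x j ≡ u) × ¬ K u)
    range-noise = AtMost-⊆ (λ { u ((j , refl) , ¬Ku) → case prepend-range P z j of λ where
      (inj₁ u∈P) → u∈P , ¬Ku
      (inj₂ (r , zr≡xj)) → ⊥-elim (¬Ku (subst K zr≡xj (proj₁ (z-new r)))) }) noise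

  GeneratesFrom⇒GoodOn : ∀ {G : Generator {U}} {K n t⋆ P} → Infinite K → GeneratesFrom G K n t⋆ → Unique P →
                         AtMost n (λ u → u ∈ P × ¬ K u) → t⋆ < length P → GoodOn G K P
  GeneratesFrom⇒GoodOn {G} {K} {P = _ ∷ P′} infinite gen uP noise (s≤s t⋆≤t)
    with x , en , prefix≡P ← extendToEnumeration infinite uP noise refl =
    subst (GoodOn G K) prefix≡P (gen x en (length P′) t⋆≤t)

  -- NC₁ from uniform generation

  GeneratesFrom⇒NCBoundedBy : ∀ {D : Collection {U}} {G : Generator {U}} {t⋆} → IsCollection D →
                              (∀ L → D L → GeneratesFrom G L 1 t⋆) → NCBoundedBy D 1 t⋆
  GeneratesFrom⇒NCBoundedBy {D} {G} {t⋆} isD gen S uS nonempty (F , cover) = ≮⇒≥ λ long →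
    1+n≰n (+-cancelʳ-≤ (length S) _ _ (begin
      suc (length F) + length S     ≡⟨ sym (cong (_+ length S) (length-outputs k)) ⟩
      length (outputs k) + length S ≡⟨ sym (length-++ (outputs k)) ⟩
      length (outputs k ++ S)       ≤⟨ Unique-⊆⇒length≤ _≟_ (proj₁ (invariant long k)) (⊆F++S long k) ⟩
      length (F ++ S)               ≡⟨ length-++ F ⟩
      length F + length S           ∎))
    where
    open ≤-Reasoning
    k = suc (length F)
    outputs : ℕ → List U
    outputs zero = []
    outputs (suc m) = G (outputs m ++ S) ∷ outputs m

    length-outputs : ∀ m → length (outputs m) ≡ m
    length-outputs zero = refl
    length-outputs (suc m) = cong suc (length-outputs m)

    -- Each output lies in ⟨S⟩, so appending it to S creates no new noise.
    invariant : t⋆ < length S → ∀ m → Unique (outputs m ++ S) × (∀ {u} → u ∈ outputs m → Closure D S 1 u)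
    invariant long zero = uS , λ ()
    invariant long (suc m) with uP , outputs⊆⟨S⟩ ← invariant long m =
      ¬Any⇒All¬ _ (proj₂ (good (proj₂ nonempty))) ∷ uP , λ where
        (here refl) → nonempty , λ L → proj₁ ∘ good
        (there u∈) → outputs⊆⟨S⟩ u∈
      where
      good : ∀ {L} → InCS D S 1 L → GoodOn G L (outputs m ++ S)
      good {L} inL@(DL , noise) = GeneratesFrom⇒GoodOn {G = G} (isD L DL) (gen L DL) uP
        (AtMost-⊆ (λ u (u∈ , ¬Lu) → case ∈-++⁻ (outputs m) u∈ of λ where
          (inj₁ u∈outputs) → ⊥-elim (¬Lu (proj₂ (outputs⊆⟨S⟩ u∈outputs) L inL))
          (inj₂ u∈S) → u∈S , ¬Lu) noise)
        (<-≤-trans long (length-++-≤ʳ S {outputs m}))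

    ⊆F++S : t⋆ < length S → ∀ m → outputs m ++ S ⊆ F ++ S
    ⊆F++S long m u∈ with ∈-++⁻ (outputs m) u∈
    ... | inj₁ u∈outputs = ∈-++⁺ˡ (cover _ (proj₂ (invariant long m) u∈outputs))
    ... | inj₂ u∈S = ∈-++⁺ʳ F u∈S

  NonUnifGenerates⇒Condition1 : ∀ {C : Collection {U}} {G : Generator {U}} → IsCollection C → NonUnifGenerates G C 1 → Condition1 C
  NonUnifGenerates⇒Condition1 {C} {G} isC gen =
    Cs ,
    (λ j L (CL , t⋆≤j) → CL , m≤n⇒m≤1+n t⋆≤j) ,
    (λ L → mk⇔ (λ CL → _ , CL , ≤-refl) (λ (_ , CL , _) → CL)) ,
    λ j → j , GeneratesFrom⇒NCBoundedBy {G = G} (λ L → isC L ∘ proj₁)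
                (λ L (CL , t⋆≤j) → GeneratesFrom-mono {G = G} t⋆≤j (proj₂ (gen L CL)))
    where
    Cs : ℕ → Collection {U}
    Cs j L = Σ (C L) λ CL → proj₁ (gen L CL) ≤ j

  -- NC₁ < ∞ bounds every NC_{i+1}

  module NoiseStep {C : Collection {U}} {a b i : ℕ}
                   (nc₁ : NCBoundedBy C 1 a) (nc : NCBoundedBy C (suc i) b) where

    representatives : ℕ → List U → List U
    representative : ℕ → List U → U

    representatives zero l = []
    representatives (suc n) l = representative n l ∷ representatives n (drop (suc b) l)

    representative n l = freshIn (Closure C (take (suc b) l) (suc i)) (representatives n (drop (suc b) l))

    length-representatives : ∀ n l → length (representatives n l) ≡ n
    length-representatives zero l = refl
    length-representatives (suc n) l = cong suc (length-representatives n (drop (suc b) l))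

    record HasBlocks (L₀ : Subset {U}) (n : ℕ) (l : List U) : Set where
      constructor hasBlocks
      field
        C-L₀ : C L₀
        unique : Unique l
        ⊆L₀ : ∀ {u} → u ∈ l → L₀ u
        long : n * suc b ≤ length l

    HasBlocks-drop : ∀ {L₀ n l} → HasBlocks L₀ (suc n) l → HasBlocks L₀ n (drop (suc b) l)
    HasBlocks-drop {n = n} {l} (hasBlocks CL₀ ul l⊆L₀ long) =
      hasBlocks CL₀ (drop⁺ (suc b) ul) (l⊆L₀ ∘ drop-⊆ (suc b))
        (subst (n * suc b ≤_) (sym (length-drop (suc b) l))
               (m+n≤o⇒m≤o∸n _ (subst (_≤ length l) (+-comm (suc b) _) long)))

    firstBlock-infinite : ∀ {L₀ n l} → HasBlocks L₀ (suc n) l → ¬ Finite (Closure C (take (suc b) l) (suc i))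
    firstBlock-infinite {L₀} {l = l} (hasBlocks CL₀ ul l⊆L₀ long) =
      NCBoundedBy⇒Infinite nc (take⁺ (suc b) ul) b<length
        (L₀ , CL₀ , [] , z≤n , λ u (u∈ , ¬L₀u) → ⊥-elim (¬L₀u (l⊆L₀ (take-⊆ (suc b) u∈))))
      where
      b<length : b < length (take (suc b) l)
      b<length = ≤-reflexive (sym (trans (length-take (suc b) l) (m≤n⇒m⊓n≡m (m+n≤o⇒m≤o (suc b) long))))

    representatives-unique : ∀ {L₀} n {l} → HasBlocks L₀ n l → Unique (representatives n l)
    representatives-unique zero _ = []
    representatives-unique (suc n) blocks =
      ¬Any⇒All¬ _ (proj₂ (freshIn-spec _ (firstBlock-infinite blocks))) ∷
      representatives-unique n (HasBlocks-drop blocks)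

    representative-∈ : ∀ {L₀ n l L} → HasBlocks L₀ (suc n) l → InCS C (take (suc b) l) (suc i) L →
                       L (representative n l)
    representative-∈ blocks inL = proj₂ (proj₁ (freshIn-spec _ (firstBlock-infinite blocks))) _ inL

    representatives-⊆ : ∀ {L₀} n {l L} → HasBlocks L₀ n l → InCS C l (suc i) L →
                        ∀ {z} → z ∈ representatives n l → L z
    representatives-⊆ (suc n) blocks inL (here refl) = representative-∈ blocks (InCS-antitone {C = C} (take-⊆ (suc b)) inL)
    representatives-⊆ (suc n) blocks inL (there z∈) =
      representatives-⊆ n (HasBlocks-drop blocks) (InCS-antitone {C = C} (drop-⊆ (suc b)) inL) z∈

    errors-outside : ∀ {T l} {L : Subset {U}} {y ys} → (∀ u → u ∈ l × ¬ L u → u ∈ y ∷ ys) →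
                     T ⊆ l → y ∉ T → ∀ u → u ∈ T × ¬ L u → u ∈ ys
    errors-outside cover T⊆l y∉T u (u∈T , ¬Lu) with cover u (T⊆l u∈T , ¬Lu)
    ... | here refl = ⊥-elim (y∉T u∈T)
    ... | there u∈ys = u∈ys

    -- The blocks are disjoint, so only the block containing the first error y can
    -- have i + 2 errors; every other block keeps its representative.
    representatives-noise : ∀ {L₀} n {l L} → HasBlocks L₀ n l → InCS C l (suc (suc i)) L →
                            AtMost 1 (λ u → u ∈ representatives n l × ¬ L u)
    representatives-noise n blocks (CL , [] , _ , cover) =
      [] , z≤n , λ u (u∈ , ¬Lu) → ⊥-elim (¬Lu (representatives-⊆ n blocks (CL , [] , z≤n , cover) u∈))
    representatives-noise zero _ _ = [] , z≤n , λ { _ (() , _) }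
    representatives-noise (suc n) {l} {L} blocks@(hasBlocks _ ul _ _) inL@(CL , y ∷ ys , s≤s |ys|≤ , cover)
      with decide (y ∈ take (suc b) l)
    ... | yes y∈first = _ ∷ [] , s≤s z≤n , λ where
      u (here refl , _) → here refl
      u (there u∈rest , ¬Lu) → ⊥-elim (¬Lu (representatives-⊆ n (HasBlocks-drop blocks)
        (CL , ys , |ys|≤ , errors-outside cover (drop-⊆ (suc b)) (Unique-take-drop-disjoint (suc b) ul y∈first)) u∈rest))
    ... | no y∉first with ys′ , |ys′|≤ , cover′ ← representatives-noise n (HasBlocks-drop blocks) (InCS-antitone {C = C} (drop-⊆ (suc b)) inL) =
      ys′ , |ys′|≤ , λ where
        u (here refl , ¬Lu) → ⊥-elim (¬Lu (representative-∈ blocks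
          (CL , ys , |ys|≤ , errors-outside cover (take-⊆ (suc b)) y∉first)))
        u (there u∈rest , ¬Lu) → cover′ u (u∈rest , ¬Lu)

    bound : NCBoundedBy C (suc (suc i)) (suc a * suc b + suc (suc i))
    bound S uS nonempty@(L₀ , CL₀ , ys₀ , |ys₀|≤ , cover₀) finite = ≮⇒≥ (1+n≰n ∘ |T|≤a)
      where
      L₀? : Decidable L₀
      L₀? u = decide (L₀ u)

      S₀ = filter L₀? S

      S⊆S₀++ys₀ : S ⊆ S₀ ++ ys₀
      S⊆S₀++ys₀ {u} u∈S with decide (L₀ u)
      ... | yes L₀u = ∈-++⁺ˡ (∈-filter⁺ L₀? u∈S L₀u)
      ... | no ¬L₀u = ∈-++⁺ʳ S₀ (cover₀ u (u∈S , ¬L₀u))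

      blocks : suc a * suc b + suc (suc i) < length S → HasBlocks L₀ (suc a) S₀
      blocks long = hasBlocks CL₀ (filter⁺ L₀? uS) (proj₂ ∘ ∈-filter⁻ L₀? {xs = S}) (+-cancelʳ-≤ (suc (suc i)) _ _ (begin
        suc a * suc b + suc (suc i) ≤⟨ <⇒≤ long ⟩
        length S                    ≤⟨ Unique-⊆⇒length≤ _≟_ uS S⊆S₀++ys₀ ⟩
        length (S₀ ++ ys₀)          ≡⟨ length-++ S₀ ⟩
        length S₀ + length ys₀      ≤⟨ +-monoʳ-≤ (length S₀) |ys₀|≤ ⟩
        length S₀ + suc (suc i)     ∎))
        where open ≤-Reasoning

      T = representatives (suc a) S₀

      |T|≤a : suc a * suc b + suc (suc i) < length S → suc a ≤ a
      |T|≤a long = subst (_≤ a) (length-representatives (suc a) S₀)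
        (nc₁ T (representatives-unique (suc a) (blocks long)) (L₀ , C⊆ L₀ (proj₂ nonempty))
             (Finite-⊆ (Closure-antitone C⊆ nonempty) finite))
        where
        C⊆ : ∀ L → InCS C S (suc (suc i)) L → InCS C T 1 L
        C⊆ L inL = proj₁ inL , representatives-noise (suc a) (blocks long) (InCS-antitone {C = C} (filter-⊆ L₀? S) inL)

  NCFinite-suc : ∀ {C : Collection {U}} → NCFinite C 1 → ∀ k → NCFinite C (suc k)
  NCFinite-suc nc₁ zero = nc₁
  NCFinite-suc nc₁ (suc k) = _ , NoiseStep.bound (proj₂ nc₁) (proj₂ (NCFinite-suc nc₁ k))

  -- Generation from a chain

  module ChainGenerator {C : Collection {U}} (Cs : ℕ → Collection {U})
                        (Cs-step : ∀ j L → Cs j L → Cs (suc j) L)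
                        (Cs-union : ∀ L → C L ⇔ (∃ λ j → Cs j L))
                        (Cs-NC₁ : ∀ j → NCFinite (Cs j) 1) where

    Cs-mono : ∀ {j k L} → j ≤ k → Cs j L → Cs k L
    Cs-mono = go ∘ ≤⇒≤′
      where
      go : ∀ {j k L} → j ≤′ k → Cs j L → Cs k L
      go ≤′-refl CsL = CsL
      go (≤′-step j≤k) CsL = Cs-step _ _ (go j≤k CsL)

    bound : ℕ → ℕ
    bound k = proj₁ (NCFinite-suc (Cs-NC₁ k) k)

    level : List U → ℕ
    level P = greatest (λ k → bound k <? length P) (length P)

    generator : Generator {U}
    generator P = freshIn (Closure (Cs (level P)) P (suc (level P))) P

    generates : NonUnifNoiseDepGenerates generator C
    generates n⋆ K CK = t⋆ , good
      where
      j = proj₁ (Equivalence.to (Cs-union K) CK)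
      m = j ⊔ n⋆
      t⋆ = m ⊔ bound m

      good : GeneratesFrom generator K n⋆ t⋆
      good x en t t⋆≤t = proj₂ (proj₁ fresh) K inK , proj₂ fresh
        where
        P = prefix x t
        t<|P| : t < length P
        t<|P| = ≤-reflexive (sym (length-prefix x t))
        k = level P
        m≤k×bound<|P| : m ≤ k × bound k < length P
        m≤k×bound<|P| = greatest-spec (λ k → bound k <? length P)
          (<⇒≤ (≤-<-trans (≤-trans (m≤m⊔n m (bound m)) t⋆≤t) t<|P|))
          (≤-<-trans (≤-trans (m≤n⊔m m (bound m)) t⋆≤t) t<|P|)
        m≤k = proj₁ m≤k×bound<|P|
        inK : InCS (Cs k) P (suc k) K
        inK = Cs-mono (≤-trans (m≤m⊔n j n⋆) m≤k) (proj₂ (Equivalence.to (Cs-union K) CK)) ,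
              AtMost-mono (≤-trans (m≤n⊔m j n⋆) (≤-trans m≤k (n≤1+n k))) (prefix-noise t en)
        fresh = freshIn-spec P (NCBoundedBy⇒Infinite (proj₂ (NCFinite-suc (Cs-NC₁ k) k))
                  (Unique-prefix t (proj₁ en)) (proj₂ m≤k×bound<|P|) (K , inK))

  Condition1⇒NonUnifNoiseDepGeneratable : ∀ {C : Collection {U}} → Condition1 C → NonUnifNoiseDepGeneratable C
  Condition1⇒NonUnifNoiseDepGeneratable (Cs , Cs-step , Cs-union , Cs-NC₁) =
    generator , generates
    where open ChainGenerator Cs Cs-step Cs-union Cs-NC₁

  -- Unions of columns

  module Columns where

    open CantorPairing

    column : U → ℕ
    column u = proj₁ (unpair (to u))

    cell : ℕ → ℕ → U
    cell c r = from (pair c r)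

    column-cell : ∀ c r → column (cell c r) ≡ c
    column-cell c r = trans (cong (proj₁ ∘ unpair) (strictlyInverseˡ (pair c r))) (cong proj₁ (unpair-pair c r))

    cell-injectiveʳ : ∀ c → Injective _≡_ _≡_ (cell c)
    cell-injectiveʳ c {r} {r′} e =
      ,-injectiveʳ (trans (sym (unpair-pair c r)) (trans (cong unpair (from-injective e)) (unpair-pair c r′)))

    cell-injectiveˡ : ∀ r → Injective _≡_ _≡_ (λ c → cell c r)
    cell-injectiveˡ r {c} {c′} e = trans (sym (column-cell c r)) (trans (cong column e) (column-cell c′ r))

    ColumnClosed : Subset {U} → Set
    ColumnClosed L = ∀ {u v} → column u ≡ column v → L u → L v

    ColumnUnions : Collection {U}
    ColumnUnions L = ∃ L × ColumnClosed L

    ColumnUnions-infinite : IsCollection ColumnUnions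
    ColumnUnions-infinite L ((u , Lu) , closed) =
      injection⇒Infinite (cell-injectiveʳ (column u)) (λ r → closed (sym (column-cell (column u) r)) Lu)

    -- Without noise x₀ ∈ K, so K contains the column of x₀; a row above the codes
    -- of everything seen so far makes the output new.
    firstColumnGenerator : Generator {U}
    firstColumnGenerator [] = from 0
    firstColumnGenerator (u ∷ P) = cell (column u) (suc (sum (map to (u ∷ P))))

    firstColumnGenerator-fresh : ∀ P → firstColumnGenerator P ∉ P
    firstColumnGenerator-fresh (u ∷ P) g∈ = 1+n≰n (begin
      suc (sum codes)                   ≤⟨ b≤pair (column u) (suc (sum codes)) ⟩
      pair (column u) (suc (sum codes)) ≡⟨ sym (strictlyInverseˡ _) ⟩
      to (firstColumnGenerator (u ∷ P)) ≤⟨ ∈⇒≤sum (∈-map⁺ to g∈) ⟩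
      sum codes                         ∎)
      where
      open ≤-Reasoning
      codes = map to (u ∷ P)

    firstColumnGenerator-generates : NonUnifGenerates firstColumnGenerator ColumnUnions 0
    firstColumnGenerator-generates K (_ , closed) = 0 , λ x (_ , _ , noise) t _ →
      closed (sym (column-cell _ _)) (x₀∈K x noise) , firstColumnGenerator-fresh (prefix x t)
      where
      x₀∈K : ∀ x → AtMost 0 (λ u → (∃ λ j → x j ≡ u) × ¬ K u) → K (x 0)
      x₀∈K x noise = decidable-stable (decide (K (x 0))) λ ¬K → AtMost-zero noise (x 0) ((0 , refl) , ¬K)

    module Diagonal (G : Generator {U}) (gen : NonUnifGenerates G ColumnUnions 1) where

      ColumnsFrom : ℕ → Subset {U}
      ColumnsFrom N u = N ≤ column u

      ColumnsFrom-ColumnUnions : ∀ N → ColumnUnions (ColumnsFrom N)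
      ColumnsFrom-ColumnUnions N = (cell N 0 , ≤-reflexive (sym (column-cell N 0))) , λ e → subst (N ≤_) e

      heads : List ℕ → List U
      heads = map (λ c → cell c 0)

      width : ℕ → ℕ → ℕ
      width k N = proj₁ (gen (ColumnsFrom N) (ColumnsFrom-ColumnUnions N)) ⊔ k

      block : ℕ → ℕ → List ℕ
      block k N = applyUpTo (N +_) (suc (width k N))

      block-bounds : ∀ {k N c} → c ∈ block k N → N ≤ c × c ≤ N + width k N
      block-bounds {N = N} c∈ with r , r<1+w , refl ← ∈-applyUpTo⁻ (N +_) c∈ =
        m≤m+n N r , +-monoʳ-≤ N (≤-pred r<1+w)

      chosen : List ℕ → ℕ
      chosen F = column (G (heads F))

      chosen∈ : ∀ {K} (UK : ColumnUnions K) k N → proj₁ (gen K UK) ≤ width k N →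
                AtMost 1 (λ u → u ∈ heads (block k N) × ¬ K u) → K (G (heads (block k N)))
      chosen∈ UK k N t⋆≤w noise =
        proj₁ (GeneratesFrom⇒GoodOn {G = G} (ColumnUnions-infinite _ UK) (proj₂ (gen _ UK)) unique noise t⋆<)
        where
        unique : Unique (heads (block k N))
        unique = map⁺ (cell-injectiveˡ 0) (applyUpTo⁺₁ (N +_) (suc (width k N)) (λ i<j _ → <⇒≢ i<j ∘ +-cancelˡ-≡ N _ _))
        t⋆< : proj₁ (gen _ UK) < length (heads (block k N))
        t⋆< = subst (proj₁ (gen _ UK) <_)
                (sym (trans (length-map (λ c → cell c 0) (block k N)) (length-applyUpTo (N +_) (suc (width k N)))))
                (s≤s t⋆≤w)

      N≤chosen : ∀ k N → N ≤ chosen (block k N)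
      N≤chosen k N = chosen∈ (ColumnsFrom-ColumnUnions N) k N (m≤m⊔n _ k) ([] , z≤n , λ where
        u (u∈ , ¬N≤u) → case ∈-map⁻ (λ c → cell c 0) u∈ of λ where
          (c , c∈ , refl) → ⊥-elim (¬N≤u (subst (N ≤_) (sym (column-cell c 0)) (proj₁ (block-bounds c∈)))))

      -- Stage k uses the columns in [start k, start (suc k)), and its block leads G
      -- to the column omitted k, which K* below leaves out.
      start : ℕ → ℕ
      start zero = 0
      start (suc k) = suc (suc (chosen (block k (start k)) + (start k + width k (start k))))

      omitted : ℕ → ℕ
      omitted k = chosen (block k (start k))

      InStage : ℕ → ℕ → Set
      InStage k n = start k ≤ n × n < start (suc k)

      block-in-stage : ∀ {k n} → n ∈ block k (start k) → InStage k n
      block-in-stage {k} n∈ = proj₁ (block-bounds n∈) ,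
        s≤s (≤-trans (proj₂ (block-bounds n∈)) (≤-trans (m≤n+m _ (omitted k)) (n≤1+n _)))

      omitted-in-stage : ∀ k → InStage k (omitted k)
      omitted-in-stage k = N≤chosen k (start k) , s≤s (≤-trans (m≤m+n _ _) (n≤1+n _))

      suc-omitted-in-stage : ∀ k → InStage k (suc (omitted k))
      suc-omitted-in-stage k = ≤-trans (N≤chosen k (start k)) (n≤1+n _) , s≤s (s≤s (m≤m+n _ _))

      start-mono : ∀ {k k′} → k < k′ → start (suc k) ≤ start k′
      start-mono {k} {suc k′} (s≤s k≤k′) with m≤n⇒m<n∨m≡n k≤k′
      ... | inj₁ k<k′ = ≤-trans (start-mono k<k′) (<⇒≤ (≤-<-trans (proj₁ (omitted-in-stage k′)) (proj₂ (omitted-in-stage k′))))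
      ... | inj₂ refl = ≤-refl

      stage-unique : ∀ {k k′ n} → InStage k n → InStage k′ n → k ≡ k′
      stage-unique {k} {k′} (k≤n , n<k) (k′≤n , n<k′) with <-cmp k k′
      ... | tri< k<k′ _ _ = ⊥-elim (<⇒≱ n<k (≤-trans (start-mono k<k′) k′≤n))
      ... | tri≈ _ k≡k′ _ = k≡k′
      ... | tri> _ _ k′<k = ⊥-elim (<⇒≱ n<k′ (≤-trans (start-mono k′<k) k≤n))

      Avoided : ℕ → Set
      Avoided n = ∀ k → n ≢ omitted k

      in-stage-avoided : ∀ {k n} → InStage k n → n ≢ omitted k → Avoided n
      in-stage-avoided n∈k n≢ k′ refl with refl ← stage-unique n∈k (omitted-in-stage k′) = n≢ refl

      K* : Subset {U}
      K* u = Avoided (column u)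

      K*-ColumnUnions : ColumnUnions K*
      K*-ColumnUnions =
        (cell (suc (omitted 0)) 0 , subst Avoided (sym (column-cell _ 0)) (in-stage-avoided (suc-omitted-in-stage 0) 1+n≢n)) ,
        λ e → subst Avoided e

      heads-noise : ∀ k → AtMost 1 (λ u → u ∈ heads (block k (start k)) × ¬ K* u)
      heads-noise k = cell (omitted k) 0 ∷ [] , s≤s z≤n , outside
        where
        outside : ∀ u → u ∈ heads (block k (start k)) × ¬ K* u → u ∈ cell (omitted k) 0 ∷ []
        outside u (u∈ , ¬K*u) with n , n∈ , refl ← ∈-map⁻ (λ c → cell c 0) {xs = block k (start k)} u∈ with n ≟ℕ omitted k
        ... | yes refl = here refl
        ... | no n≢ = ⊥-elim (¬K*u (subst Avoided (sym (column-cell n 0)) (in-stage-avoided (block-in-stage {k} n∈) n≢)))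

      contradiction : ⊥
      contradiction = chosen∈ K*-ColumnUnions k (start k) (m≤n⊔m _ k) (heads-noise k) k refl
        where
        k = proj₁ (gen K* K*-ColumnUnions)

    ColumnUnions-not-generatable : ¬ NonUnifGeneratable ColumnUnions 1
    ColumnUnions-not-generatable (G , gen) = Diagonal.contradiction G gen

mainTheorem10 : ExcludedMiddle (lsuc 0ℓ) →
    (U : Set) → U ↔ ℕ →
    ((C : Collection {U}) → IsCollection C → (i : ℕ) → 1 ≤ i →
      (Condition1 C ⇔ NonUnifGeneratable C i)
      × (Condition1 C ⇔ NonUnifNoiseDepGeneratable C))
    × Σ (Collection {U}) (λ C → IsCollection C
        × NonUnifGeneratable C 0 × ¬ NonUnifGeneratable C 1)
mainTheorem10 em U U↔ℕ = characterisation , separation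
  where
  open Classical em U U↔ℕ
  open Columns

  characterisation : (C : Collection {U}) → IsCollection C → (i : ℕ) → 1 ≤ i →
                     (Condition1 C ⇔ NonUnifGeneratable C i) × (Condition1 C ⇔ NonUnifNoiseDepGeneratable C)
  characterisation C isC i 1≤i =
    mk⇔ (λ chain → let G , gen = Condition1⇒NonUnifNoiseDepGeneratable chain in G , gen i)
        (λ (G , gen) → NonUnifGenerates⇒Condition1 {G = G} isC (NonUnifGenerates-mono {G = G} 1≤i gen)) ,
    mk⇔ Condition1⇒NonUnifNoiseDepGeneratable
        (λ (G , gen) → NonUnifGenerates⇒Condition1 {G = G} isC (gen 1))

  separation : Σ (Collection {U}) λ C → IsCollection C × NonUnifGeneratable C 0 × ¬ NonUnifGeneratable C 1
  separation = ColumnUnions , ColumnUnions-infinite ,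
               (firstColumnGenerator , firstColumnGenerator-generates) , ColumnUnions-not-generatable
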